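{- If $\mathbb{C}$ is a complete m-algebra (resp. c-algebra), then $\mathbb{C}\cong(\mathbb{C}^\bullet)_\bullet$. Moreover, if $\mathbb{H}$ is a complete supported heterogeneous m-algebra (resp. complete heterogeneous c-algebra), then $\mathbb{H}\cong\mathbb{C}^\bullet$ for some complete m-algebra (resp. c-algebra) $\mathbb{C}$ iff $\mathbb{H}\cong(\mathbb{H}_\bullet)^\bullet$.
   Context: Complete m-algebras are pairs $(\mathbb{A},\nabla)$ with $\mathbb{A}$ a complete Boolean algebra and $\nabla$ monotone; complete c-algebras are $(\mathbb{A},>)$ with $>$ finitely meet-preserving in the second coordinate. For such $\mathbb{C}$, $\mathbb{C}^\bullet = (\mathbb{A}, \mathcal{P}(\mathbb{A}), [\ni], \langle\not\ni\rangle, \langle\nu\rangle, [\nu^c])$ (resp. $(\mathbb{A}, \mathcal{P}(\mathbb{A}), [\ni], [\not\ni\rangle, \vartriangleright)$) with $[\ni]a = \{b\mid b\le a\}$, $\langle\not\ni\rangle a=\{b\mid a\nleq b\}$, $[\not\ni\rangle a=\{b\mid a\le b\}$, $\langle\nu\rangle B=\bigvee\{\nabla b\mid b\in B\}$, $[\nu^c]B=\bigwedge\{\nabla b\mid b\notin B\}$, $B\vartriangleright a=\bigwedge\{b>a\mid b\in B\}$. A heterogeneous m-algebra $\mathbb{H}=(\mathbb{A},\mathbb{B},[\ni],\langle\not\ni\rangle,\langle\nu\rangle,[\nu^c])$ consists of Boolean algebras with $\langle\nu\rangle,[\nu^c]:\mathbb{B}\to\mathbb{A}$ join- resp. meet-preserving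 and $[\ni],\langle\not\ni\rangle:\mathbb{A}\to\mathbb{B}$ meet- resp. join-preserving; supported means $\langle\nu\rangle[\ni]a=[\nu^c]\langle\not\ni\rangle a$. A heterogeneous c-algebra $(\mathbb{A},\mathbb{B},[\ni],[\not\ni\rangle,\vartriangleright)$ has $[\ni]$ meet-preserving, $[\not\ni\rangle$ join-reversing, $\vartriangleright:\mathbb{B}\times\mathbb{A}\to\mathbb{A}$ join-reversing in first and meet-preserving in second coordinate; complete means complete algebras and complete preservation properties. For such $\mathbb{H}$, $\mathbb{H}_\bullet = (\mathbb{A},\nabla)$ with $\nabla a = \langle\nu\rangle[\ni]a = [\nu^c]\langle\not\ni\rangle a$ (resp. $(\mathbb{A},>)$ with $a>b = ([\ni]a\wedge[\not\ni\rangle a)\vartriangleright b$). -}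

module Defs where

open import Level using (Level; suc; Lift; lift; lower)
open import Data.Bool using (Bool; true; false; _∧_; _∨_; not)
open import Data.Product using (Σ; ∃; _×_; _,_; proj₁; proj₂)
open import Data.Empty using (⊥-elim)
open import Relation.Nullary using (¬_; Dec; yes; no; does)
open import Relation.Binary.PropositionalEquality using (_≡_; refl; cong; cong₂; sym; trans)
open import Algebra.Lattice.Structures using (IsBooleanAlgebra)
open import Function.Bundles using (_⇔_)

LEM : (ℓ : Level) → Set (suc ℓ)
LEM ℓ = (P : Set ℓ) → Dec P

record RawCBA (ℓ : Level) : Set (suc ℓ) where
  infix  4 _≈_ _≤_
  infixr 7 _⊓_
  infixr 6 _⊔_
  field
    Carrier : Set ℓ
    _≈_     : Carrier → Carrier → Set ℓ
    _⊔_     : Carrier → Carrier → Carrier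
    _⊓_     : Carrier → Carrier → Carrier
    ∼_      : Carrier → Carrier
    ⊤ ⊥     : Carrier
    ⋁ ⋀     : (Carrier → Set ℓ) → Carrier

  _≤_ : Carrier → Carrier → Set ℓ
  x ≤ y = (x ⊓ y) ≈ x

img : ∀ {ℓ} {X : Set ℓ} (R : RawCBA ℓ) → (X → Set ℓ) → (X → RawCBA.Carrier R) → RawCBA.Carrier R → Set ℓ
img R P f y = ∃ λ x → P x × RawCBA._≈_ R y (f x)

record IsCBA {ℓ} (R : RawCBA ℓ) : Set (suc ℓ) where
  open RawCBA R
  field
    isBooleanAlgebra : IsBooleanAlgebra _≈_ _⊔_ _⊓_ ∼_ ⊤ ⊥
    ⋁-upper : ∀ (S : Carrier → Set ℓ) x → S x → x ≤ ⋁ S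
    ⋁-least : ∀ (S : Carrier → Set ℓ) y → (∀ x → S x → x ≤ y) → ⋁ S ≤ y
    ⋀-lower : ∀ (S : Carrier → Set ℓ) x → S x → ⋀ S ≤ x
    ⋀-great : ∀ (S : Carrier → Set ℓ) y → (∀ x → S x → y ≤ x) → y ≤ ⋀ S

record CBA (ℓ : Level) : Set (suc ℓ) where
  field
    raw   : RawCBA ℓ
    isCBA : IsCBA raw
  open RawCBA raw public
  open IsCBA isCBA public
  open IsBooleanAlgebra isBooleanAlgebra public using (refl; sym; trans; ∧-cong)

record BAIso {ℓ} (R S : RawCBA ℓ) : Set ℓ where
  private
    module R = RawCBA R
    module S = RawCBA S
  field
    to      : R.Carrier → S.Carrier
    from    : S.Carrier → R.Carrier
    to-cong   : ∀ {x y} → x R.≈ y → to x S.≈ to y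
    from-cong : ∀ {x y} → x S.≈ y → from x R.≈ from y
    from∘to : ∀ x → from (to x) R.≈ x
    to∘from : ∀ y → to (from y) S.≈ y
    to-⊔ : ∀ x y → to (x R.⊔ y) S.≈ (to x S.⊔ to y)
    to-⊓ : ∀ x y → to (x R.⊓ y) S.≈ (to x S.⊓ to y)
    to-¬ : ∀ x → to (R.∼ x) S.≈ S.∼ (to x)
    to-⊤ : to R.⊤ S.≈ S.⊤
    to-⊥ : to R.⊥ S.≈ S.⊥

-- The powerset algebra 𝒫(𝔸) of (the setoid underlying) a complete
-- Boolean algebra: subsets are ≈-invariant Bool-valued predicates
-- (faithful to classical subsets, given LEM).

module Powerset {ℓ} (lem : LEM ℓ) (A : CBA ℓ) where
  private
    module A = CBA A

  Subset : Set ℓ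
  Subset = Σ (A.Carrier → Bool) λ S → ∀ x y → x A.≈ y → S x ≡ S y

  _∈_ : A.Carrier → Subset → Set ℓ
  x ∈ S = Lift ℓ (proj₁ S x ≡ true)

  dec-≡ : (P Q : Set ℓ) → (P → Q) → (Q → P) → does (lem P) ≡ does (lem Q)
  dec-≡ P Q f g with lem P | lem Q
  ... | yes _ | yes _ = refl
  ... | no _  | no _  = refl
  ... | yes p | no ¬q = ⊥-elim (¬q (f p))
  ... | no ¬p | yes q = ⊥-elim (¬p (g q))

  ⟦_⟧ : (P : A.Carrier → Set ℓ) → (∀ {x y} → x A.≈ y → P x → P y) → Subset
  ⟦ P ⟧ resp = (λ x → does (lem (P x))) ,
               (λ x y x≈y → dec-≡ (P x) (P y) (resp x≈y) (resp (A.sym x≈y)))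

  private
    ≈-trans : ∀ {x y z} → x A.≈ y → y A.≈ z → x A.≈ z
    ≈-trans = A.trans

    ≤-respˡ : ∀ {a x y} → x A.≈ y → x A.≤ a → y A.≤ a
    ≤-respˡ x≈y x≤a = A.trans (A.∧-cong (A.sym x≈y) A.refl) (A.trans x≤a x≈y)

    ≤-respʳ : ∀ {a x y} → x A.≈ y → a A.≤ x → a A.≤ y
    ≤-respʳ x≈y a≤x = A.trans (A.∧-cong A.refl (A.sym x≈y)) a≤x

  𝒫 : RawCBA ℓ
  𝒫 = record
    { Carrier = Subset
    ; _≈_ = λ S T → ∀ x → proj₁ S x ≡ proj₁ T x
    ; _⊔_ = λ S T → (λ x → proj₁ S x ∨ proj₁ T x) ,
                    (λ x y e → cong₂ _∨_ (proj₂ S x y e) (proj₂ T x y e))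
    ; _⊓_ = λ S T → (λ x → proj₁ S x ∧ proj₁ T x) ,
                    (λ x y e → cong₂ _∧_ (proj₂ S x y e) (proj₂ T x y e))
    ; ∼_  = λ S → (λ x → not (proj₁ S x)) , (λ x y e → cong not (proj₂ S x y e))
    ; ⊤ = (λ _ → true) , (λ _ _ _ → refl)
    ; ⊥ = (λ _ → false) , (λ _ _ _ → refl)
    ; ⋁ = λ 𝓑 → ⟦ (λ x → ∃ λ S → 𝓑 S × x ∈ S) ⟧
                  (λ {x} {y} e → λ { (S , S∈ , x∈S) → S , S∈ , lift (trans (sym (proj₂ S x y e)) (lower x∈S)) })
    ; ⋀ = λ 𝓑 → ⟦ (λ x → ∀ S → 𝓑 S → x ∈ S) ⟧
                  (λ {x} {y} e h S S∈ → lift (trans (sym (proj₂ S x y e)) (lower (h S S∈))))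
    }

  [∋] : A.Carrier → Subset
  [∋] a = ⟦ (λ b → b A.≤ a) ⟧ ≤-respˡ

  ⟨∌⟩ : A.Carrier → Subset
  ⟨∌⟩ a = ⟦ (λ b → ¬ (a A.≤ b)) ⟧ (λ e h a≤y → h (≤-respʳ (A.sym e) a≤y))

  [∌⟩ : A.Carrier → Subset
  [∌⟩ a = ⟦ (λ b → a A.≤ b) ⟧ ≤-respʳ

  _∉_ : A.Carrier → Subset → Set ℓ
  x ∉ S = Lift ℓ (proj₁ S x ≡ false)

record MAlg (ℓ : Level) : Set (suc ℓ) where
  field
    𝔸 : CBA ℓ
    ∇ : CBA.Carrier 𝔸 → CBA.Carrier 𝔸

record IsCompleteMAlg {ℓ} (C : MAlg ℓ) : Set ℓ where
  open MAlg C
  open CBA 𝔸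
  field
    ∇-mono : ∀ {x y} → x ≤ y → ∇ x ≤ ∇ y

CompleteMAlg : (ℓ : Level) → Set (suc ℓ)
CompleteMAlg ℓ = Σ (MAlg ℓ) IsCompleteMAlg

record MIso {ℓ} (C D : MAlg ℓ) : Set ℓ where
  private
    module C = MAlg C
    module D = MAlg D
  field
    iso : BAIso (CBA.raw C.𝔸) (CBA.raw D.𝔸)
  open BAIso iso public
  field
    to-∇ : ∀ x → CBA._≈_ D.𝔸 (to (C.∇ x)) (D.∇ (to x))

record HetMAlg (ℓ : Level) : Set (suc ℓ) where
  field
    𝔸 : CBA ℓ
    𝔹 : RawCBA ℓ
  private
    module A = CBA 𝔸
    module B = RawCBA 𝔹
  field
    [∋]   : A.Carrier → B.Carrier
    ⟨∌⟩   : A.Carrier → B.Carrier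
    ⟨ν⟩   : B.Carrier → A.Carrier
    [νᶜ]  : B.Carrier → A.Carrier

record IsCompleteSupportedHetMAlg {ℓ} (H : HetMAlg ℓ) : Set (suc ℓ) where
  open HetMAlg H
  private
    module A = CBA 𝔸
    module B = RawCBA 𝔹
  field
    𝔹-complete : IsCBA 𝔹
    [∋]-cong  : ∀ {x y} → x A.≈ y → [∋] x B.≈ [∋] y
    ⟨∌⟩-cong  : ∀ {x y} → x A.≈ y → ⟨∌⟩ x B.≈ ⟨∌⟩ y
    ⟨ν⟩-cong  : ∀ {x y} → x B.≈ y → ⟨ν⟩ x A.≈ ⟨ν⟩ y
    [νᶜ]-cong : ∀ {x y} → x B.≈ y → [νᶜ] x A.≈ [νᶜ] y
    [∋]-⋀   : ∀ S → [∋] (A.⋀ S) B.≈ B.⋀ (img 𝔹 S [∋])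
    ⟨∌⟩-⋁   : ∀ S → ⟨∌⟩ (A.⋁ S) B.≈ B.⋁ (img 𝔹 S ⟨∌⟩)
    ⟨ν⟩-⋁   : ∀ S → ⟨ν⟩ (B.⋁ S) A.≈ A.⋁ (img A.raw S ⟨ν⟩)
    [νᶜ]-⋀  : ∀ S → [νᶜ] (B.⋀ S) A.≈ A.⋀ (img A.raw S [νᶜ])
    supported : ∀ a → ⟨ν⟩ ([∋] a) A.≈ [νᶜ] (⟨∌⟩ a)

CompleteSupportedHetMAlg : (ℓ : Level) → Set (suc ℓ)
CompleteSupportedHetMAlg ℓ = Σ (HetMAlg ℓ) IsCompleteSupportedHetMAlg

record HetMIso {ℓ} (H K : HetMAlg ℓ) : Set ℓ where
  private
    module H = HetMAlg H
    module K = HetMAlg K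
    module KA = CBA K.𝔸
    module KB = RawCBA K.𝔹
  field
    isoA : BAIso (CBA.raw H.𝔸) (CBA.raw K.𝔸)
    isoB : BAIso H.𝔹 K.𝔹
  private
    module fA = BAIso isoA
    module fB = BAIso isoB
  field
    to-[∋]  : ∀ a → fB.to (H.[∋] a) KB.≈ K.[∋] (fA.to a)
    to-⟨∌⟩  : ∀ a → fB.to (H.⟨∌⟩ a) KB.≈ K.⟨∌⟩ (fA.to a)
    to-⟨ν⟩  : ∀ b → fA.to (H.⟨ν⟩ b) KA.≈ K.⟨ν⟩ (fB.to b)
    to-[νᶜ] : ∀ b → fA.to (H.[νᶜ] b) KA.≈ K.[νᶜ] (fB.to b)

_•ᵐ : ∀ {ℓ} → LEM ℓ → MAlg ℓ → HetMAlg ℓ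
(lem •ᵐ) C = record
  { 𝔸 = 𝔸
  ; 𝔹 = 𝒫
  ; [∋] = [∋]
  ; ⟨∌⟩ = ⟨∌⟩
  ; ⟨ν⟩ = λ B → A.⋁ (img A.raw (λ b → b ∈ B) ∇)
  ; [νᶜ] = λ B → A.⋀ (img A.raw (λ b → b ∉ B) ∇)
  }
  where
    open MAlg C
    module A = CBA 𝔸
    open Powerset lem 𝔸

_•↓ᵐ : ∀ {ℓ} → HetMAlg ℓ → MAlg ℓ
H •↓ᵐ = record { 𝔸 = 𝔸 ; ∇ = λ a → ⟨ν⟩ ([∋] a) }
  where open HetMAlg H

record CAlg (ℓ : Level) : Set (suc ℓ) where
  field
    𝔸   : CBA ℓ
    _▹_ : CBA.Carrier 𝔸 → CBA.Carrier 𝔸 → CBA.Carrier 𝔸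

record IsCompleteCAlg {ℓ} (C : CAlg ℓ) : Set ℓ where
  open CAlg C
  open CBA 𝔸
  field
    ▹-cong : ∀ {a a′ b b′} → a ≈ a′ → b ≈ b′ → (a ▹ b) ≈ (a′ ▹ b′)
    ▹-⊓    : ∀ a b c → (a ▹ (b ⊓ c)) ≈ ((a ▹ b) ⊓ (a ▹ c))
    ▹-⊤    : ∀ a → (a ▹ ⊤) ≈ ⊤

CompleteCAlg : (ℓ : Level) → Set (suc ℓ)
CompleteCAlg ℓ = Σ (CAlg ℓ) IsCompleteCAlg

record CIso {ℓ} (C D : CAlg ℓ) : Set ℓ where
  private
    module C = CAlg C
    module D = CAlg D
  field
    iso : BAIso (CBA.raw C.𝔸) (CBA.raw D.𝔸)
  open BAIso iso public
  field
    to-▹ : ∀ x y → CBA._≈_ D.𝔸 (to (x C.▹ y)) (to x D.▹ to y)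

record HetCAlg (ℓ : Level) : Set (suc ℓ) where
  field
    𝔸 : CBA ℓ
    𝔹 : RawCBA ℓ
  private
    module A = CBA 𝔸
    module B = RawCBA 𝔹
  field
    [∋]  : A.Carrier → B.Carrier
    [∌⟩  : A.Carrier → B.Carrier
    _▷_  : B.Carrier → A.Carrier → A.Carrier

record IsCompleteHetCAlg {ℓ} (H : HetCAlg ℓ) : Set (suc ℓ) where
  open HetCAlg H
  private
    module A = CBA 𝔸
    module B = RawCBA 𝔹
  field
    𝔹-complete : IsCBA 𝔹
    [∋]-cong : ∀ {x y} → x A.≈ y → [∋] x B.≈ [∋] y
    [∌⟩-cong : ∀ {x y} → x A.≈ y → [∌⟩ x B.≈ [∌⟩ y
    ▷-cong   : ∀ {b b′ a a′} → b B.≈ b′ → a A.≈ a′ → (b ▷ a) A.≈ (b′ ▷ a′)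
    [∋]-⋀ : ∀ S → [∋] (A.⋀ S) B.≈ B.⋀ (img 𝔹 S [∋])
    [∌⟩-⋁ : ∀ S → [∌⟩ (A.⋁ S) B.≈ B.⋀ (img 𝔹 S [∌⟩)
    ▷-⋁ˡ  : ∀ S a → (B.⋁ S ▷ a) A.≈ A.⋀ (img A.raw S (λ b → b ▷ a))
    ▷-⋀ʳ  : ∀ b S → (b ▷ A.⋀ S) A.≈ A.⋀ (img A.raw S (λ a → b ▷ a))

CompleteHetCAlg : (ℓ : Level) → Set (suc ℓ)
CompleteHetCAlg ℓ = Σ (HetCAlg ℓ) IsCompleteHetCAlg

record HetCIso {ℓ} (H K : HetCAlg ℓ) : Set ℓ where
  private
    module H = HetCAlg H
    module K = HetCAlg K
    module KA = CBA K.𝔸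
    module KB = RawCBA K.𝔹
  field
    isoA : BAIso (CBA.raw H.𝔸) (CBA.raw K.𝔸)
    isoB : BAIso H.𝔹 K.𝔹
  private
    module fA = BAIso isoA
    module fB = BAIso isoB
  field
    to-[∋] : ∀ a → fB.to (H.[∋] a) KB.≈ K.[∋] (fA.to a)
    to-[∌⟩ : ∀ a → fB.to (H.[∌⟩ a) KB.≈ K.[∌⟩ (fA.to a)
    to-▷   : ∀ b a → fA.to (b H.▷ a) KA.≈ (fB.to b K.▷ fA.to a)

_•ᶜ : ∀ {ℓ} → LEM ℓ → CAlg ℓ → HetCAlg ℓ
(lem •ᶜ) C = record
  { 𝔸 = 𝔸
  ; 𝔹 = 𝒫
  ; [∋] = [∋]
  ; [∌⟩ = [∌⟩
  ; _▷_ = λ B a → A.⋀ (img A.raw (λ b → b ∈ B) (λ b → b ▹ a))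
  }
  where
    open CAlg C
    module A = CBA 𝔸
    open Powerset lem 𝔸

_•↓ᶜ : ∀ {ℓ} → HetCAlg ℓ → CAlg ℓ
H •↓ᶜ = record { 𝔸 = 𝔸 ; _▹_ = λ a b → (([∋] a) B.⊓ ([∌⟩ a)) ▷ b }
  where
    open HetCAlg H
    module B = RawCBA 𝔹

module Submission where

-- Monotonicity of ∇ gives ∇ a = ⋁ {∇ b | b ≤ a} = ⟨ν⟩ [∋] a, and in a c-algebra [∋] a ∧ [∌⟩ a
-- is the ≈-class of a, so ([∋] a ∧ [∌⟩ a) ▷ b = a > b: the identity is an isomorphism ℂ ≅ (ℂ•)•.
-- If ℍ ≅ ℂ• with ℂ complete, the first component of that isomorphism is an isomorphism ℍ• ≅ ℂ,
-- because (ℂ•)• ≅ ℂ by the identity; since (-)• carries isomorphisms to isomorphisms, ℍ ≅ ℂ• ≅ (ℍ•)•.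
-- Conversely ℍ• is complete whenever ℍ is, since completely join- or meet-preserving maps are
-- monotone and completely meet-preserving ones preserve finite meets.

open import Defs
open import Level using (Level; Lift; lift; lower)
open import Data.Bool using (true; _∧_)
open import Data.Bool.Properties using (∧-conicalˡ; ∧-conicalʳ)
open import Data.Empty using () renaming (⊥ to Empty)
open import Data.Product using (∃; _×_; _,_; proj₁; proj₂)
open import Data.Sum using (_⊎_; inj₁; inj₂)
open import Function.Base using (_∘_)
open import Function.Bundles using (_⇔_; mk⇔; module Equivalence)
open import Function.Related.TypeIsomorphisms using (¬-cong-⇔)
open import Relation.Nullary using (Dec; yes; no; does)
open import Relation.Nullary.Decidable using (dec-true)
open import Relation.Binary.Core using (_Preserves_⟶_; _Preserves₂_⟶_⟶_)
open import Relation.Binary.Definitions using (Transitive)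
import Relation.Binary.PropositionalEquality as ≡
open import Algebra.Lattice.Bundles using (BooleanAlgebra)
open import Algebra.Lattice.Structures using (IsBooleanAlgebra)

module CBAProperties {ℓ} (A : CBA ℓ) where
  open CBA A

  private
    booleanAlgebra : BooleanAlgebra ℓ ℓ
    booleanAlgebra = record { isBooleanAlgebra = isBooleanAlgebra }

  open BooleanAlgebra booleanAlgebra public using (setoid)
  open IsBooleanAlgebra isBooleanAlgebra using (∧-comm; ∧-assoc; ∧-congˡ; ∧-congʳ)
  open IsBooleanAlgebra isBooleanAlgebra public using (∨-cong; ¬-cong)
  open import Algebra.Lattice.Properties.BooleanAlgebra booleanAlgebra using (∧-idem; ∧-identityʳ)
  open import Relation.Binary.Reasoning.Setoid setoid

  ≤-refl : ∀ {x} → x ≤ x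
  ≤-refl {x} = ∧-idem x

  ≤-reflexive : ∀ {x y} → x ≈ y → x ≤ y
  ≤-reflexive {x} x≈y = trans (∧-congˡ (sym x≈y)) (∧-idem x)

  ≤-antisym : ∀ {x y} → x ≤ y → y ≤ x → x ≈ y
  ≤-antisym {x} {y} x≤y y≤x = begin
    x      ≈⟨ x≤y ⟨
    x ⊓ y  ≈⟨ ∧-comm x y ⟩
    y ⊓ x  ≈⟨ y≤x ⟩
    y      ∎

  ≤-respˡ-≈ : ∀ {x y z} → x ≈ y → x ≤ z → y ≤ z
  ≤-respˡ-≈ x≈y x≤z = trans (∧-congʳ (sym x≈y)) (trans x≤z x≈y)

  ≤-respʳ-≈ : ∀ {x y z} → y ≈ z → x ≤ y → x ≤ z
  ≤-respʳ-≈ y≈z x≤y = trans (∧-congˡ (sym y≈z)) x≤y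

  x⊓y≤x : ∀ x y → x ⊓ y ≤ x
  x⊓y≤x x y = begin
    (x ⊓ y) ⊓ x  ≈⟨ ∧-comm (x ⊓ y) x ⟩
    x ⊓ (x ⊓ y)  ≈⟨ ∧-assoc x x y ⟨
    (x ⊓ x) ⊓ y  ≈⟨ ∧-congʳ (∧-idem x) ⟩
    x ⊓ y        ∎

  x⊓y≤y : ∀ x y → x ⊓ y ≤ y
  x⊓y≤y x y = trans (∧-assoc x y y) (∧-congˡ (∧-idem y))

  ⊓-greatest : ∀ {x y z} → z ≤ x → z ≤ y → z ≤ x ⊓ y
  ⊓-greatest {x} {y} {z} z≤x z≤y = trans (sym (∧-assoc z x y)) (trans (∧-congʳ z≤x) z≤y)

  monotone⇒congruent : ∀ {f} → f Preserves _≤_ ⟶ _≤_ → f Preserves _≈_ ⟶ _≈_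
  monotone⇒congruent f-mono x≈y = ≤-antisym (f-mono (≤-reflexive x≈y)) (f-mono (≤-reflexive (sym x≈y)))

  infix 4 _⊆≈_ _≋_

  _⊆≈_ : (S T : Carrier → Set ℓ) → Set ℓ
  S ⊆≈ T = ∀ {x} → S x → ∃ λ y → T y × x ≈ y

  _≋_ : (S T : Carrier → Set ℓ) → Set ℓ
  S ≋ T = S ⊆≈ T × T ⊆≈ S

  ⋁-mono : ∀ {S T} → S ⊆≈ T → ⋁ S ≤ ⋁ T
  ⋁-mono {S} {T} S⊆T = ⋁-least S (⋁ T) λ x Sx →
    let y , Ty , x≈y = S⊆T Sx in ≤-respˡ-≈ (sym x≈y) (⋁-upper T y Ty)

  ⋀-antimono : ∀ {S T} → S ⊆≈ T → ⋀ T ≤ ⋀ S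
  ⋀-antimono {S} {T} S⊆T = ⋀-great S (⋀ T) λ x Sx →
    let y , Ty , x≈y = S⊆T Sx in ≤-respʳ-≈ (sym x≈y) (⋀-lower T y Ty)

  ⋁-cong : ∀ {S T} → S ≋ T → ⋁ S ≈ ⋁ T
  ⋁-cong (S⊆T , T⊆S) = ≤-antisym (⋁-mono S⊆T) (⋁-mono T⊆S)

  ⋀-cong : ∀ {S T} → S ≋ T → ⋀ S ≈ ⋀ T
  ⋀-cong (S⊆T , T⊆S) = ≤-antisym (⋀-antimono T⊆S) (⋀-antimono S⊆T)

  img-⊆≈ : ∀ {X : Set ℓ} {P Q : X → Set ℓ} {f g : X → Carrier} →
           (∀ {x} → P x → Q x) → (∀ x → f x ≈ g x) → img raw P f ⊆≈ img raw Q g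
  img-⊆≈ P⊆Q f≈g (x , Px , y≈fx) = _ , (x , P⊆Q Px , refl) , trans y≈fx (f≈g x)

  ｛_,_｝ : Carrier → Carrier → Carrier → Set ℓ
  ｛ x , y ｝ z = z ≈ x ⊎ z ≈ y

  ∅ : Carrier → Set ℓ
  ∅ _ = Lift ℓ Empty

  ⋀-pair : ∀ x y → ⋀ ｛ x , y ｝ ≈ x ⊓ y
  ⋀-pair x y = ≤-antisym
    (⊓-greatest (⋀-lower _ x (inj₁ refl)) (⋀-lower _ y (inj₂ refl)))
    (⋀-great _ _ λ { z (inj₁ z≈x) → ≤-respʳ-≈ (sym z≈x) (x⊓y≤x x y)
                   ; z (inj₂ z≈y) → ≤-respʳ-≈ (sym z≈y) (x⊓y≤y x y) })

  x≤y⇒⋁｛x,y｝≈y : ∀ {x y} → x ≤ y → ⋁ ｛ x , y ｝ ≈ y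
  x≤y⇒⋁｛x,y｝≈y {x} {y} x≤y = ≤-antisym
    (⋁-least _ y λ { z (inj₁ z≈x) → ≤-respˡ-≈ (sym z≈x) x≤y
                   ; z (inj₂ z≈y) → ≤-reflexive z≈y })
    (⋁-upper _ y (inj₂ refl))

  ⋀-∅ : ⋀ ∅ ≈ ⊤
  ⋀-∅ = ≤-antisym (∧-identityʳ _) (⋀-great _ _ λ _ ())

module CompleteMapProperties {ℓ} (A B : CBA ℓ) (g : CBA.Carrier A → CBA.Carrier B)
                             (g-cong : g Preserves CBA._≈_ A ⟶ CBA._≈_ B) where
  private
    module A = CBA A
    module B = CBA B
    module A′ = CBAProperties A
    module B′ = CBAProperties B

  Preserves-⋁ : Set (Level.suc ℓ)
  Preserves-⋁ = ∀ S → g (A.⋁ S) B.≈ B.⋁ (img B.raw S g)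

  Preserves-⋀ : Set (Level.suc ℓ)
  Preserves-⋀ = ∀ S → g (A.⋀ S) B.≈ B.⋀ (img B.raw S g)

  img-pair : ∀ x y → img B.raw A′.｛ x , y ｝ g B′.≋ B′.｛ g x , g y ｝
  img-pair x y =
    (λ { (w , inj₁ w≈x , z≈gw) → g x , inj₁ B.refl , B.trans z≈gw (g-cong w≈x)
       ; (w , inj₂ w≈y , z≈gw) → g y , inj₂ B.refl , B.trans z≈gw (g-cong w≈y) }) ,
    (λ { (inj₁ z≈gx) → _ , (x , inj₁ A.refl , z≈gx) , B.refl
       ; (inj₂ z≈gy) → _ , (y , inj₂ A.refl , z≈gy) , B.refl })

  img-∅ : img B.raw A′.∅ g B′.≋ B′.∅
  img-∅ = (λ { (_ , () , _) }) , λ ()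

  ⋀-preserving⇒⊓-preserving : Preserves-⋀ → ∀ x y → g (x A.⊓ y) B.≈ g x B.⊓ g y
  ⋀-preserving⇒⊓-preserving g-⋀ x y = begin
    g (x A.⊓ y)                  ≈⟨ g-cong (A′.⋀-pair x y) ⟨
    g (A.⋀ A′.｛ x , y ｝)         ≈⟨ g-⋀ _ ⟩
    B.⋀ (img B.raw A′.｛ x , y ｝ g) ≈⟨ B′.⋀-cong (img-pair x y) ⟩
    B.⋀ B′.｛ g x , g y ｝         ≈⟨ B′.⋀-pair (g x) (g y) ⟩
    g x B.⊓ g y                  ∎
    where open import Relation.Binary.Reasoning.Setoid B′.setoid

  ⋀-preserving⇒⊤-preserving : Preserves-⋀ → g A.⊤ B.≈ B.⊤
  ⋀-preserving⇒⊤-preserving g-⋀ =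
    B.trans (g-cong (A.sym A′.⋀-∅)) (B.trans (g-⋀ _) (B.trans (B′.⋀-cong img-∅) B′.⋀-∅))

  ⋀-preserving⇒monotone : Preserves-⋀ → g Preserves A._≤_ ⟶ B._≤_
  ⋀-preserving⇒monotone g-⋀ {x} {y} x≤y =
    B.trans (B.sym (⋀-preserving⇒⊓-preserving g-⋀ x y)) (g-cong x≤y)

  ⋁-preserving⇒monotone : Preserves-⋁ → g Preserves A._≤_ ⟶ B._≤_
  ⋁-preserving⇒monotone g-⋁ {x} {y} x≤y =
    B′.≤-respʳ-≈ (B.trans (B.sym (g-⋁ _)) (g-cong (A′.x≤y⇒⋁｛x,y｝≈y x≤y)))
                 (B.⋁-upper _ _ (x , inj₁ A.refl , B.refl))

BAIso-refl : ∀ {ℓ} (A : CBA ℓ) → BAIso (CBA.raw A) (CBA.raw A)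
BAIso-refl A = record
  { to = λ x → x ; from = λ x → x ; to-cong = λ x≈y → x≈y ; from-cong = λ x≈y → x≈y
  ; from∘to = λ _ → refl ; to∘from = λ _ → refl
  ; to-⊔ = λ _ _ → refl ; to-⊓ = λ _ _ → refl ; to-¬ = λ _ → refl ; to-⊤ = refl ; to-⊥ = refl
  }
  where open CBA A

BAIso-trans : ∀ {ℓ} {R S T : RawCBA ℓ} →
              Transitive (RawCBA._≈_ R) → Transitive (RawCBA._≈_ T) →
              BAIso R S → BAIso S T → BAIso R T
BAIso-trans R-trans T-trans f g = record
  { to = g.to ∘ f.to ; from = f.from ∘ g.from
  ; to-cong = g.to-cong ∘ f.to-cong ; from-cong = f.from-cong ∘ g.from-cong
  ; from∘to = λ x → R-trans (f.from-cong (g.from∘to _)) (f.from∘to x)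
  ; to∘from = λ x → T-trans (g.to-cong (f.to∘from _)) (g.to∘from x)
  ; to-⊔ = λ x y → T-trans (g.to-cong (f.to-⊔ x y)) (g.to-⊔ _ _)
  ; to-⊓ = λ x y → T-trans (g.to-cong (f.to-⊓ x y)) (g.to-⊓ _ _)
  ; to-¬ = λ x → T-trans (g.to-cong (f.to-¬ x)) (g.to-¬ _)
  ; to-⊤ = T-trans (g.to-cong f.to-⊤) g.to-⊤
  ; to-⊥ = T-trans (g.to-cong f.to-⊥) g.to-⊥
  }
  where
    module f = BAIso f
    module g = BAIso g

module BAIsoProperties {ℓ} (A B : CBA ℓ) (i : BAIso (CBA.raw A) (CBA.raw B)) where
  open BAIso i
  private
    module A = CBA A
    module B = CBA B
    module A′ = CBAProperties A
    module B′ = CBAProperties B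

  to≈⇒≈from : ∀ {x y} → to x B.≈ y → x A.≈ from y
  to≈⇒≈from to-x≈y = A.trans (A.sym (from∘to _)) (from-cong to-x≈y)

  inverse : BAIso B.raw A.raw
  inverse = record
    { to = from ; from = to ; to-cong = from-cong ; from-cong = to-cong
    ; from∘to = to∘from ; to∘from = from∘to
    ; to-⊔ = λ x y → from-homo (B.trans (to-⊔ _ _) (B′.∨-cong (to∘from x) (to∘from y)))
    ; to-⊓ = λ x y → from-homo (B.trans (to-⊓ _ _) (B.∧-cong (to∘from x) (to∘from y)))
    ; to-¬ = λ x → from-homo (B.trans (to-¬ _) (B′.¬-cong (to∘from x)))
    ; to-⊤ = from-homo to-⊤
    ; to-⊥ = from-homo to-⊥
    }
    where
      from-homo : ∀ {x y} → to x B.≈ y → from y A.≈ x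
      from-homo = A.sym ∘ to≈⇒≈from

  to-mono : to Preserves A._≤_ ⟶ B._≤_
  to-mono x≤y = B.trans (B.sym (to-⊓ _ _)) (to-cong x≤y)

  from-mono : from Preserves B._≤_ ⟶ A._≤_
  from-mono x≤y = A.trans (A.sym (BAIso.to-⊓ inverse _ _)) (from-cong x≤y)

  from-≤⇔≤-to : ∀ {x y} → from y A.≤ x ⇔ y B.≤ to x
  from-≤⇔≤-to {x} {y} = mk⇔
    (λ from-y≤x → B′.≤-respˡ-≈ (to∘from y) (to-mono from-y≤x))
    (λ y≤to-x → A′.≤-respʳ-≈ (from∘to x) (from-mono y≤to-x))

  ≤-from⇔to-≤ : ∀ {x y} → x A.≤ from y ⇔ to x B.≤ y
  ≤-from⇔to-≤ {x} {y} = mk⇔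
    (λ x≤from-y → B′.≤-respʳ-≈ (to∘from y) (to-mono x≤from-y))
    (λ to-x≤y → A′.≤-respˡ-≈ (from∘to x) (from-mono to-x≤y))

  to-⋁ : ∀ S → to (A.⋁ S) B.≈ B.⋁ (img B.raw S to)
  to-⋁ S = B′.≤-antisym
    (Equivalence.to ≤-from⇔to-≤ (A.⋁-least S _ λ x Sx →
      Equivalence.from ≤-from⇔to-≤ (B.⋁-upper _ _ (x , Sx , B.refl))))
    (B.⋁-least _ _ λ { y (x , Sx , y≈to-x) →
      B′.≤-respˡ-≈ (B.sym y≈to-x) (to-mono (A.⋁-upper S x Sx)) })

  to-⋀ : ∀ S → to (A.⋀ S) B.≈ B.⋀ (img B.raw S to)
  to-⋀ S = B′.≤-antisym
    (B.⋀-great _ _ λ { y (x , Sx , y≈to-x) →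
      B′.≤-respʳ-≈ (B.sym y≈to-x) (to-mono (A.⋀-lower S x Sx)) })
    (Equivalence.to from-≤⇔≤-to (A.⋀-great S _ λ x Sx →
      Equivalence.from from-≤⇔≤-to (B.⋀-lower _ _ (x , Sx , B.refl))))

  module _ {P : A.Carrier → Set ℓ} (P-resp : ∀ {x y} → x A.≈ y → P x → P y)
           {φ : A.Carrier → A.Carrier} {ψ : B.Carrier → B.Carrier} (ψ-cong : ψ Preserves B._≈_ ⟶ B._≈_)
           (to∘φ≈ψ∘to : ∀ x → to (φ x) B.≈ ψ (to x)) where

    img-conjugate : img B.raw (img A.raw P φ) to B′.≋ img B.raw (P ∘ from) ψ
    img-conjugate =
      (λ { (y , (x , Px , y≈φx) , z≈to-y) →
           ψ (to x) , (to x , P-resp (A.sym (from∘to x)) Px , B.refl) ,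
           B.trans z≈to-y (B.trans (to-cong y≈φx) (to∘φ≈ψ∘to x)) }) ,
      (λ { {z} (y , P-from-y , z≈ψy) →
           z , (φ (from y) , (from y , P-from-y , A.refl) ,
                B.trans z≈ψy (B.sym (B.trans (to∘φ≈ψ∘to (from y)) (ψ-cong (to∘from y))))) , B.refl })

    to-⋁-img : to (A.⋁ (img A.raw P φ)) B.≈ B.⋁ (img B.raw (P ∘ from) ψ)
    to-⋁-img = B.trans (to-⋁ _) (B′.⋁-cong img-conjugate)

    to-⋀-img : to (A.⋀ (img A.raw P φ)) B.≈ B.⋀ (img B.raw (P ∘ from) ψ)
    to-⋀-img = B.trans (to-⋀ _) (B′.⋀-cong img-conjugate)

-- A subset is a pair whose proof component is not determined by its characteristic function,
-- so implicit subset arguments of the lemmas below generally have to be supplied explicitly.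
module PowersetProperties {ℓ} (lem : LEM ℓ) (A : CBA ℓ) where
  open Powerset lem A
  private
    module A = CBA A
    module A′ = CBAProperties A
    module 𝒫 = RawCBA 𝒫

    does≡true⇔ : ∀ {P : Set ℓ} → Lift ℓ (does (lem P) ≡.≡ true) ⇔ P
    does≡true⇔ {P} = mk⇔ (witness (lem P) ∘ lower) (lift ∘ dec-true (lem P))
      where
        witness : (P? : Dec P) → does P? ≡.≡ true → P
        witness (yes p) _  = p
        witness (no _)  ()

  does-cong : ∀ {P Q : Set ℓ} → P ⇔ Q → does (lem P) ≡.≡ does (lem Q)
  does-cong P⇔Q = dec-≡ _ _ (Equivalence.to P⇔Q) (Equivalence.from P⇔Q)

  𝒫-sym : ∀ {S T} → S 𝒫.≈ T → T 𝒫.≈ S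
  𝒫-sym S≈T x = ≡.sym (S≈T x)

  𝒫-trans : Transitive 𝒫._≈_
  𝒫-trans S≈T T≈U x = ≡.trans (S≈T x) (T≈U x)

  ∈-resp-≈ : ∀ {S x y} → x A.≈ y → x ∈ S → y ∈ S
  ∈-resp-≈ {S} x≈y (lift x∈S) = lift (≡.trans (≡.sym (proj₂ S _ _ x≈y)) x∈S)

  ∉-resp-≈ : ∀ {S x y} → x A.≈ y → x ∉ S → y ∉ S
  ∉-resp-≈ {S} x≈y (lift x∉S) = lift (≡.trans (≡.sym (proj₂ S _ _ x≈y)) x∉S)

  ∈-resp-𝒫≈ : ∀ {S T x} → S 𝒫.≈ T → x ∈ S → x ∈ T
  ∈-resp-𝒫≈ S≈T (lift x∈S) = lift (≡.trans (≡.sym (S≈T _)) x∈S)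

  ∈-⊓ : ∀ {S T x} → x ∈ (S 𝒫.⊓ T) ⇔ (x ∈ S × x ∈ T)
  ∈-⊓ {S} {T} {x} = mk⇔
    (λ (lift x∈S⊓T) → lift (∧-conicalˡ _ _ x∈S⊓T) , lift (∧-conicalʳ _ _ x∈S⊓T))
    (λ (lift x∈S , lift x∈T) → lift (≡.cong₂ _∧_ x∈S x∈T))

  ∈-[∋] : ∀ {a b} → b ∈ [∋] a ⇔ b A.≤ a
  ∈-[∋] = does≡true⇔

  ∈-[∌⟩ : ∀ {a b} → b ∈ [∌⟩ a ⇔ a A.≤ b
  ∈-[∌⟩ = does≡true⇔

  ∈-[∋]⊓[∌⟩ : ∀ {a b} → b ∈ ([∋] a 𝒫.⊓ [∌⟩ a) ⇔ b A.≈ a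
  ∈-[∋]⊓[∌⟩ {a} {b} = mk⇔
    (λ b∈ → let b∈[∋]a , b∈[∌⟩a = Equivalence.to (∈-⊓ {[∋] a} {[∌⟩ a}) b∈ in
            A′.≤-antisym (Equivalence.to (∈-[∋] {a}) b∈[∋]a) (Equivalence.to (∈-[∌⟩ {a}) b∈[∌⟩a))
    (λ b≈a → Equivalence.from (∈-⊓ {[∋] a} {[∌⟩ a})
      (Equivalence.from (∈-[∋] {a}) (A′.≤-reflexive b≈a) ,
       Equivalence.from (∈-[∌⟩ {a}) (A′.≤-reflexive (A.sym b≈a))))

module _ {ℓ} (lem : LEM ℓ) (A B : CBA ℓ) (i : BAIso (CBA.raw A) (CBA.raw B)) where
  private
    module 𝒫A = Powerset lem A
    module 𝒫B = Powerset lem B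
  open BAIso i

  𝒫-map : BAIso 𝒫A.𝒫 𝒫B.𝒫
  𝒫-map = record
    { to = λ S → proj₁ S ∘ from , λ x y x≈y → proj₂ S _ _ (from-cong x≈y)
    ; from = λ S → proj₁ S ∘ to , λ x y x≈y → proj₂ S _ _ (to-cong x≈y)
    ; to-cong = λ S≈T → S≈T ∘ from ; from-cong = λ S≈T → S≈T ∘ to
    ; from∘to = λ S x → proj₂ S _ _ (from∘to x)
    ; to∘from = λ S x → proj₂ S _ _ (to∘from x)
    ; to-⊔ = λ _ _ _ → ≡.refl ; to-⊓ = λ _ _ _ → ≡.refl ; to-¬ = λ _ _ → ≡.refl
    ; to-⊤ = λ _ → ≡.refl ; to-⊥ = λ _ → ≡.refl
    }

module MAlgebraProperties {ℓ} (lem : LEM ℓ) where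

  module _ (C : MAlg ℓ) where
    open MAlg C
    open PowersetProperties lem 𝔸
    private
      module A = CBA 𝔸
      module A′ = CBAProperties 𝔸
      module 𝒫 = RawCBA (Powerset.𝒫 lem 𝔸)
      module C• = HetMAlg ((lem •ᵐ) C)

    •ᵐ-⟨ν⟩-cong : ∀ {B B′} → B 𝒫.≈ B′ → C•.⟨ν⟩ B A.≈ C•.⟨ν⟩ B′
    •ᵐ-⟨ν⟩-cong {B} {B′} B≈B′ = A′.⋁-cong
      (A′.img-⊆≈ (∈-resp-𝒫≈ {B} {B′} B≈B′) (λ _ → A.refl) ,
       A′.img-⊆≈ (∈-resp-𝒫≈ {B′} {B} (𝒫-sym {B} {B′} B≈B′)) (λ _ → A.refl))

    ∇≈⟨ν⟩[∋] : ∇ Preserves A._≤_ ⟶ A._≤_ → ∀ a → ∇ a A.≈ C•.⟨ν⟩ (C•.[∋] a)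
    ∇≈⟨ν⟩[∋] ∇-mono a = A′.≤-antisym
      (A.⋁-upper _ _ (a , Equivalence.from ∈-[∋] A′.≤-refl , A.refl))
      (A.⋁-least _ _ λ { x (b , b∈[∋]a , x≈∇b) →
        A′.≤-respˡ-≈ (A.sym x≈∇b) (∇-mono (Equivalence.to ∈-[∋] b∈[∋]a)) })

  id≅•↓ᵐ∘•ᵐ : (C : CompleteMAlg ℓ) → MIso (proj₁ C) ((lem •ᵐ) (proj₁ C) •↓ᵐ)
  id≅•↓ᵐ∘•ᵐ (C , C-complete) = record
    { iso = BAIso-refl (MAlg.𝔸 C)
    ; to-∇ = ∇≈⟨ν⟩[∋] C (IsCompleteMAlg.∇-mono C-complete)
    }

  module _ {C D : MAlg ℓ} (∇ᴰ-cong : MAlg.∇ D Preserves CBA._≈_ (MAlg.𝔸 D) ⟶ CBA._≈_ (MAlg.𝔸 D))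
           (f : MIso C D) where
    private
      module C = MAlg C
      module D = MAlg D
      module CA = CBA C.𝔸
      module DA = CBA D.𝔸
    open MIso f
    open BAIsoProperties C.𝔸 D.𝔸 iso
    open PowersetProperties lem C.𝔸

    MIso-sym : MIso D C
    MIso-sym = record
      { iso = inverse
      ; to-∇ = λ y → CA.sym (to≈⇒≈from (DA.trans (to-∇ (from y)) (∇ᴰ-cong (to∘from y))))
      }

    •ᵐ-map : HetMIso ((lem •ᵐ) C) ((lem •ᵐ) D)
    •ᵐ-map = record
      { isoA = iso
      ; isoB = 𝒫-map lem C.𝔸 D.𝔸 iso
      ; to-[∋] = λ _ _ → does-cong from-≤⇔≤-to
      ; to-⟨∌⟩ = λ _ _ → does-cong (¬-cong-⇔ ≤-from⇔to-≤)
      ; to-⟨ν⟩ = λ B → to-⋁-img (∈-resp-≈ {S = B}) ∇ᴰ-cong to-∇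
      ; to-[νᶜ] = λ B → to-⋀-img (∉-resp-≈ {S = B}) ∇ᴰ-cong to-∇
      }

  HetMIso-trans : ∀ {H K L : HetMAlg ℓ} →
                  Transitive (RawCBA._≈_ (HetMAlg.𝔹 H)) → Transitive (RawCBA._≈_ (HetMAlg.𝔹 L)) →
                  HetMIso H K → HetMIso K L → HetMIso H L
  HetMIso-trans {H} {K} {L} Hᴮ-trans Lᴮ-trans f g = record
    { isoA = BAIso-trans HA.trans LA.trans f.isoA g.isoA
    ; isoB = BAIso-trans Hᴮ-trans Lᴮ-trans f.isoB g.isoB
    ; to-[∋] = λ a → Lᴮ-trans (gB.to-cong (f.to-[∋] a)) (g.to-[∋] _)
    ; to-⟨∌⟩ = λ a → Lᴮ-trans (gB.to-cong (f.to-⟨∌⟩ a)) (g.to-⟨∌⟩ _)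
    ; to-⟨ν⟩ = λ b → LA.trans (gA.to-cong (f.to-⟨ν⟩ b)) (g.to-⟨ν⟩ _)
    ; to-[νᶜ] = λ b → LA.trans (gA.to-cong (f.to-[νᶜ] b)) (g.to-[νᶜ] _)
    }
    where
      module f = HetMIso f
      module g = HetMIso g
      module gA = BAIso g.isoA
      module gB = BAIso g.isoB
      module HA = CBA (HetMAlg.𝔸 H)
      module LA = CBA (HetMAlg.𝔸 L)

  HetMIso⇒MIso-•↓ᵐ : ∀ {H C} → IsCompleteMAlg C → HetMIso H ((lem •ᵐ) C) → MIso (H •↓ᵐ) C
  HetMIso⇒MIso-•↓ᵐ {H} {C} C-complete f = record
    { iso = f.isoA
    ; to-∇ = λ a → begin
        fA.to (H.⟨ν⟩ (H.[∋] a))    ≈⟨ f.to-⟨ν⟩ _ ⟩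
        C•.⟨ν⟩ (fB.to (H.[∋] a))   ≈⟨ •ᵐ-⟨ν⟩-cong C {fB.to (H.[∋] a)} {C•.[∋] (fA.to a)} (f.to-[∋] a) ⟩
        C•.⟨ν⟩ (C•.[∋] (fA.to a))  ≈⟨ ∇≈⟨ν⟩[∋] C (IsCompleteMAlg.∇-mono C-complete) (fA.to a) ⟨
        MAlg.∇ C (fA.to a)         ∎
    }
    where
      module H = HetMAlg H
      module C• = HetMAlg ((lem •ᵐ) C)
      module f = HetMIso f
      module fA = BAIso f.isoA
      module fB = BAIso f.isoB
      open import Relation.Binary.Reasoning.Setoid (CBAProperties.setoid (MAlg.𝔸 C))

  •↓ᵐ-complete : ∀ {H} → IsCompleteSupportedHetMAlg H → IsCompleteMAlg (H •↓ᵐ)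
  •↓ᵐ-complete {H} H-complete = record
    { ∇-mono = λ a≤b → ⟨ν⟩-map.⋁-preserving⇒monotone ⟨ν⟩-⋁ ([∋]-map.⋀-preserving⇒monotone [∋]-⋀ a≤b) }
    where
      open HetMAlg H
      open IsCompleteSupportedHetMAlg H-complete
      𝔹-cba : CBA ℓ
      𝔹-cba = record { raw = 𝔹 ; isCBA = 𝔹-complete }
      module [∋]-map = CompleteMapProperties 𝔸 𝔹-cba [∋] [∋]-cong
      module ⟨ν⟩-map = CompleteMapProperties 𝔹-cba 𝔸 ⟨ν⟩ ⟨ν⟩-cong

  ∃≅•ᵐ⇔≅•ᵐ∘•↓ᵐ : (H : CompleteSupportedHetMAlg ℓ) →
                 (∃ λ (C : CompleteMAlg ℓ) → HetMIso (proj₁ H) ((lem •ᵐ) (proj₁ C)))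
                 ⇔ HetMIso (proj₁ H) ((lem •ᵐ) (proj₁ H •↓ᵐ))
  ∃≅•ᵐ⇔≅•ᵐ∘•↓ᵐ (H , H-complete) = mk⇔
    (λ ((C , C-complete) , H≅C•) →
      HetMIso-trans (CBA.trans 𝔹-cba) (λ {S T U} → PowersetProperties.𝒫-trans lem 𝔸 {S} {T} {U}) H≅C•
        (•ᵐ-map (∇-cong (•↓ᵐ-complete H-complete))
                (MIso-sym (∇-cong C-complete) (HetMIso⇒MIso-•↓ᵐ C-complete H≅C•))))
    (λ H≅H•• → (H •↓ᵐ , •↓ᵐ-complete H-complete) , H≅H••)
    where
      open HetMAlg H
      𝔹-cba : CBA ℓ
      𝔹-cba = record { raw = 𝔹 ; isCBA = IsCompleteSupportedHetMAlg.𝔹-complete H-complete }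
      ∇-cong : ∀ {C} → IsCompleteMAlg C → MAlg.∇ C Preserves CBA._≈_ (MAlg.𝔸 C) ⟶ CBA._≈_ (MAlg.𝔸 C)
      ∇-cong {C} C-complete = CBAProperties.monotone⇒congruent (MAlg.𝔸 C) (IsCompleteMAlg.∇-mono C-complete)

module CAlgebraProperties {ℓ} (lem : LEM ℓ) where

  module _ (C : CAlg ℓ)
           (▹-cong : CAlg._▹_ C Preserves₂ CBA._≈_ (CAlg.𝔸 C) ⟶ CBA._≈_ (CAlg.𝔸 C) ⟶ CBA._≈_ (CAlg.𝔸 C)) where
    open CAlg C
    open PowersetProperties lem 𝔸
    private
      module A = CBA 𝔸
      module A′ = CBAProperties 𝔸
      module 𝒫 = RawCBA (Powerset.𝒫 lem 𝔸)
      module C• = HetCAlg ((lem •ᶜ) C)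

    •ᶜ-▷-cong : ∀ {B B′ a a′} → B 𝒫.≈ B′ → a A.≈ a′ → B C•.▷ a A.≈ B′ C•.▷ a′
    •ᶜ-▷-cong {B} {B′} B≈B′ a≈a′ = A′.⋀-cong
      (A′.img-⊆≈ (∈-resp-𝒫≈ {B} {B′} B≈B′) (λ _ → ▹-cong A.refl a≈a′) ,
       A′.img-⊆≈ (∈-resp-𝒫≈ {B′} {B} (𝒫-sym {B} {B′} B≈B′)) (λ _ → ▹-cong A.refl (A.sym a≈a′)))

    ▹≈[∋]⊓[∌⟩▷ : ∀ a b → a ▹ b A.≈ (C•.[∋] a 𝒫.⊓ C•.[∌⟩ a) C•.▷ b
    ▹≈[∋]⊓[∌⟩▷ a b = A′.≤-antisym
      (A.⋀-great _ _ λ { x (c , c∈ , x≈c▹b) →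
        A′.≤-reflexive (A.sym (A.trans x≈c▹b (▹-cong (Equivalence.to (∈-[∋]⊓[∌⟩ {a}) c∈) A.refl))) })
      (A.⋀-lower _ _ (a , Equivalence.from (∈-[∋]⊓[∌⟩ {a}) A.refl , A.refl))

  id≅•↓ᶜ∘•ᶜ : (C : CompleteCAlg ℓ) → CIso (proj₁ C) ((lem •ᶜ) (proj₁ C) •↓ᶜ)
  id≅•↓ᶜ∘•ᶜ (C , C-complete) = record
    { iso = BAIso-refl (CAlg.𝔸 C)
    ; to-▹ = ▹≈[∋]⊓[∌⟩▷ C (IsCompleteCAlg.▹-cong C-complete)
    }

  module _ {C D : CAlg ℓ}
           (▹ᴰ-cong : CAlg._▹_ D Preserves₂ CBA._≈_ (CAlg.𝔸 D) ⟶ CBA._≈_ (CAlg.𝔸 D) ⟶ CBA._≈_ (CAlg.𝔸 D))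
           (f : CIso C D) where
    private
      module C = CAlg C
      module D = CAlg D
      module CA = CBA C.𝔸
      module DA = CBA D.𝔸
    open CIso f
    open BAIsoProperties C.𝔸 D.𝔸 iso
    open PowersetProperties lem C.𝔸

    CIso-sym : CIso D C
    CIso-sym = record
      { iso = inverse
      ; to-▹ = λ x y → CA.sym (to≈⇒≈from
          (DA.trans (to-▹ (from x) (from y)) (▹ᴰ-cong (to∘from x) (to∘from y))))
      }

    •ᶜ-map : HetCIso ((lem •ᶜ) C) ((lem •ᶜ) D)
    •ᶜ-map = record
      { isoA = iso
      ; isoB = 𝒫-map lem C.𝔸 D.𝔸 iso
      ; to-[∋] = λ _ _ → does-cong from-≤⇔≤-to
      ; to-[∌⟩ = λ _ _ → does-cong ≤-from⇔to-≤
      ; to-▷ = λ B a → to-⋀-img (∈-resp-≈ {S = B}) (λ x≈y → ▹ᴰ-cong x≈y DA.refl) (λ x → to-▹ x a)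
      }

  HetCIso-trans : ∀ {H K L : HetCAlg ℓ} →
                  Transitive (RawCBA._≈_ (HetCAlg.𝔹 H)) → Transitive (RawCBA._≈_ (HetCAlg.𝔹 L)) →
                  HetCIso H K → HetCIso K L → HetCIso H L
  HetCIso-trans {H} {K} {L} Hᴮ-trans Lᴮ-trans f g = record
    { isoA = BAIso-trans HA.trans LA.trans f.isoA g.isoA
    ; isoB = BAIso-trans Hᴮ-trans Lᴮ-trans f.isoB g.isoB
    ; to-[∋] = λ a → Lᴮ-trans (gB.to-cong (f.to-[∋] a)) (g.to-[∋] _)
    ; to-[∌⟩ = λ a → Lᴮ-trans (gB.to-cong (f.to-[∌⟩ a)) (g.to-[∌⟩ _)
    ; to-▷ = λ b a → LA.trans (gA.to-cong (f.to-▷ b a)) (g.to-▷ _ _)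
    }
    where
      module f = HetCIso f
      module g = HetCIso g
      module gA = BAIso g.isoA
      module gB = BAIso g.isoB
      module HA = CBA (HetCAlg.𝔸 H)
      module LA = CBA (HetCAlg.𝔸 L)

  HetCIso⇒CIso-•↓ᶜ : ∀ {H C} → IsCompleteCAlg C → HetCIso H ((lem •ᶜ) C) → CIso (H •↓ᶜ) C
  HetCIso⇒CIso-•↓ᶜ {H} {C} C-complete f = record
    { iso = f.isoA
    ; to-▹ = λ a b → begin
        fA.to ([∋]⊓[∌⟩ᴴ a H.▷ b)             ≈⟨ f.to-▷ _ _ ⟩
        fB.to ([∋]⊓[∌⟩ᴴ a) C•.▷ fA.to b      ≈⟨ •ᶜ-▷-cong C ▹-cong {fB.to ([∋]⊓[∌⟩ᴴ a)} {[∋]⊓[∌⟩ (fA.to a)}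
                                                            (to-[∋]⊓[∌⟩ a) CA.refl ⟩
        [∋]⊓[∌⟩ (fA.to a) C•.▷ fA.to b       ≈⟨ ▹≈[∋]⊓[∌⟩▷ C ▹-cong (fA.to a) (fA.to b) ⟨
        fA.to a C.▹ fA.to b                  ∎
    }
    where
      module H = HetCAlg H
      module H𝔹 = RawCBA H.𝔹
      module C = CAlg C
      module CA = CBA C.𝔸
      module C• = HetCAlg ((lem •ᶜ) C)
      module 𝒫 = RawCBA (Powerset.𝒫 lem C.𝔸)
      module f = HetCIso f
      module fA = BAIso f.isoA
      module fB = BAIso f.isoB
      open IsCompleteCAlg C-complete using (▹-cong)
      open import Relation.Binary.Reasoning.Setoid (CBAProperties.setoid C.𝔸)

      [∋]⊓[∌⟩ᴴ : CBA.Carrier H.𝔸 → H𝔹.Carrier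
      [∋]⊓[∌⟩ᴴ a = H.[∋] a H𝔹.⊓ H.[∌⟩ a

      [∋]⊓[∌⟩ : CA.Carrier → 𝒫.Carrier
      [∋]⊓[∌⟩ c = C•.[∋] c 𝒫.⊓ C•.[∌⟩ c

      to-[∋]⊓[∌⟩ : ∀ a → fB.to ([∋]⊓[∌⟩ᴴ a) 𝒫.≈ [∋]⊓[∌⟩ (fA.to a)
      to-[∋]⊓[∌⟩ a x = ≡.trans (fB.to-⊓ _ _ x) (≡.cong₂ _∧_ (f.to-[∋] a x) (f.to-[∌⟩ a x))

  •↓ᶜ-complete : ∀ {H} → IsCompleteHetCAlg H → IsCompleteCAlg (H •↓ᶜ)
  •↓ᶜ-complete {H} H-complete = record
    { ▹-cong = λ a≈a′ → ▷-cong (𝔹.∧-cong ([∋]-cong a≈a′) ([∌⟩-cong a≈a′))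
    ; ▹-⊓ = λ _ → X▷-map.⋀-preserving⇒⊓-preserving _ (▷-⋀ʳ _)
    ; ▹-⊤ = λ _ → X▷-map.⋀-preserving⇒⊤-preserving _ (▷-⋀ʳ _)
    }
    where
      open HetCAlg H
      open IsCompleteHetCAlg H-complete
      𝔹-cba : CBA ℓ
      𝔹-cba = record { raw = 𝔹 ; isCBA = 𝔹-complete }
      module 𝔹 = CBA 𝔹-cba
      module X▷-map (X : 𝔹.Carrier) = CompleteMapProperties 𝔸 𝔸 (X ▷_) (▷-cong 𝔹.refl)

  ∃≅•ᶜ⇔≅•ᶜ∘•↓ᶜ : (H : CompleteHetCAlg ℓ) →
                 (∃ λ (C : CompleteCAlg ℓ) → HetCIso (proj₁ H) ((lem •ᶜ) (proj₁ C)))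
                 ⇔ HetCIso (proj₁ H) ((lem •ᶜ) (proj₁ H •↓ᶜ))
  ∃≅•ᶜ⇔≅•ᶜ∘•↓ᶜ (H , H-complete) = mk⇔
    (λ ((C , C-complete) , H≅C•) →
      HetCIso-trans (CBA.trans 𝔹-cba) (λ {S T U} → PowersetProperties.𝒫-trans lem 𝔸 {S} {T} {U}) H≅C•
        (•ᶜ-map (IsCompleteCAlg.▹-cong (•↓ᶜ-complete H-complete))
                (CIso-sym (IsCompleteCAlg.▹-cong C-complete) (HetCIso⇒CIso-•↓ᶜ C-complete H≅C•))))
    (λ H≅H•• → (H •↓ᶜ , •↓ᶜ-complete H-complete) , H≅H••)
    where
      open HetCAlg H
      𝔹-cba : CBA ℓ
      𝔹-cba = record { raw = 𝔹 ; isCBA = IsCompleteHetCAlg.𝔹-complete H-complete }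

proposition3 : {ℓ : Level} → (lem : LEM ℓ) →
    -- m-algebras
    (((C : CompleteMAlg ℓ) → MIso (proj₁ C) ((lem •ᵐ) (proj₁ C) •↓ᵐ))
     × ((H : CompleteSupportedHetMAlg ℓ) →
          (∃ λ (C : CompleteMAlg ℓ) → HetMIso (proj₁ H) ((lem •ᵐ) (proj₁ C)))
          ⇔ HetMIso (proj₁ H) ((lem •ᵐ) (proj₁ H •↓ᵐ))))
    ×
    -- c-algebras
    (((C : CompleteCAlg ℓ) → CIso (proj₁ C) ((lem •ᶜ) (proj₁ C) •↓ᶜ))
     × ((H : CompleteHetCAlg ℓ) →
          (∃ λ (C : CompleteCAlg ℓ) → HetCIso (proj₁ H) ((lem •ᶜ) (proj₁ C)))
          ⇔ HetCIso (proj₁ H) ((lem •ᶜ) (proj₁ H •↓ᶜ))))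
proposition3 lem =
  (id≅•↓ᵐ∘•ᵐ , ∃≅•ᵐ⇔≅•ᵐ∘•↓ᵐ) , (id≅•↓ᶜ∘•ᶜ , ∃≅•ᶜ⇔≅•ᶜ∘•↓ᶜ)
  where
    open MAlgebraProperties lem
    open CAlgebraProperties lem
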